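{- For any connected graph $G$ of order $n$, $D(G)\leq n-\mathrm{diam}(G)+1$.
   Context: $\mathrm{diam}(G)$ is the diameter of $G$. The distinguishing number $D(G)$ is the minimum number of colours in a (not necessarily proper) vertex colouring of $G$ such that the identity is the only automorphism of $G$ preserving the colouring. -}

module Defs where

open import Data.Nat using (ℕ; zero; suc; _≤_; _<_)
open import Data.Fin using (Fin)
open import Data.Empty using (⊥)
open import Data.Bool using (Bool; true; false)
open import Data.Product using (Σ; ∃; _×_; _,_)
open import Relation.Binary.PropositionalEquality using (_≡_)
open import Function.Definitions using (Injective)

record Graph (n : ℕ) : Set where
  field
    adj     : Fin n → Fin n → Bool
    adj-sym : ∀ u v → adj u v ≡ adj v u
    adj-irr : ∀ v → adj v v ≡ false
open Graph public

Adj : ∀ {n} → Graph n → Fin n → Fin n → Set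
Adj G u v = adj G u v ≡ true

data Walk {n : ℕ} (G : Graph n) : Fin n → Fin n → ℕ → Set where
  here : ∀ {v} → Walk G v v zero
  step : ∀ {u w v k} → Adj G u w → Walk G w v k → Walk G u v (suc k)

Connected : ∀ {n} → Graph n → Set
Connected G = ∀ u v → ∃ λ k → Walk G u v k

Dist : ∀ {n} → Graph n → Fin n → Fin n → ℕ → Set
Dist G u v d = Walk G u v d × (∀ k → Walk G u v k → d ≤ k)

Diam : ∀ {n} → Graph n → ℕ → Set
Diam G d = (∃ λ u → ∃ λ v → Dist G u v d)
         × (∀ u v e → Dist G u v e → e ≤ d)

-- Automorphisms: bijections of Fin n (injective = bijective on Fin n)
-- preserving adjacency and non-adjacency.
IsAutomorphism : ∀ {n} → Graph n → (Fin n → Fin n) → Set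
IsAutomorphism G σ = Injective _≡_ _≡_ σ × (∀ u v → adj G (σ u) (σ v) ≡ adj G u v)

Distinguishing : ∀ {n k} → Graph n → (Fin n → Fin k) → Set
Distinguishing {n} G c =
  ∀ (σ : Fin n → Fin n) → IsAutomorphism G σ → (∀ v → c (σ v) ≡ c v) → ∀ v → σ v ≡ v

HasDistinguishingColouring : ∀ {n} → Graph n → ℕ → Set
HasDistinguishingColouring {n} G k = Σ (Fin n → Fin k) λ c → Distinguishing G c

IsDistNumber : ∀ {n} → Graph n → ℕ → Set
IsDistNumber G m = HasDistinguishingColouring G m
                 × (∀ k → k < m → (HasDistinguishingColouring G k → ⊥))

-- Let x₀ = v₀, v₁, …, v_d be a shortest path between two vertices at distance d = diam G.
-- Colour v₁, …, v_d with one common colour and give each of the other n − d vertices a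
-- colour of its own: n − d + 1 colours in all. An automorphism σ preserving this colouring
-- fixes every vertex with a private colour, in particular x₀, and permutes the v_k. Since
-- σ preserves distances from x₀ = σ x₀ and v_j is at distance j from x₀, σ v_k = v_j forces
-- j ≤ k; an injective self-map of {1, …, d} that never increases an index is the identity.
module Submission where

open import Defs
open import Data.Nat using (ℕ; zero; suc; _≤_; _∸_; _+_; s≤s⁻¹)
open import Data.Nat.Properties
  using (m∸[m∸n]≡n; m≤n+o⇒m∸n≤o; +-comm; ≮⇒≥; <⇒≱; module ≤-Reasoning)
open import Data.Fin as Fin using (Fin; zero; suc; toℕ; punchOut; _<_)
open import Data.Fin.Properties
  using (_≟_; <-cmp; suc-injective; punchOut-cong; punchOut-injective; toℕ≤pred[n]; <-irrefl)
open import Data.Fin.Induction using (<-wellFounded)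
open import Induction.WellFounded using (Acc; acc)
open import Data.Empty using (⊥-elim)
open import Data.Product using (Σ; ∃; _,_; proj₁; proj₂)
open import Data.Sum using (_⊎_; inj₁; inj₂)
open import Relation.Nullary using (yes; no)
open import Relation.Binary using (tri<; tri≈; tri>)
open import Relation.Binary.PropositionalEquality
  using (_≡_; _≢_; _≗_; refl; sym; trans; cong; subst; subst₂)
open import Function using (id)
open import Function.Definitions using (Injective)

record MarksImage {d n m} (p : Fin d → Fin n) (c : Fin n → Fin (suc m)) : Set where
  field
    image⇒zero         : ∀ i → c (p i) ≡ zero
    zero⇒image         : ∀ w → c w ≡ zero → ∃ λ i → p i ≡ w
    injective-off-zero : ∀ w w′ → c w ≡ c w′ → w ≡ w′ ⊎ c w ≡ zero

-- Removing p zero from both the image and the vertex set (via punchOut) reduces to d − 1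
-- marked vertices among n − 1; the colour count n ∸ d is unchanged.
markImage : ∀ {d n} (p : Fin d → Fin n) → Injective _≡_ _≡_ p →
            Σ (Fin n → Fin (suc (n ∸ d))) (MarksImage p)
markImage {zero} p _ = suc , record
  { image⇒zero = λ ()
  ; zero⇒image = λ _ ()
  ; injective-off-zero = λ _ _ e → inj₁ (suc-injective e)
  }
markImage {suc d} {zero} p _ with () ← p zero
markImage {suc d} {suc n} p p-inj = c , record
  { image⇒zero = image⇒zero
  ; zero⇒image = zero⇒image
  ; injective-off-zero = injective-off-zero
  }
  where
  a : Fin (suc n)
  a = p zero

  a≢p[suc] : ∀ i → a ≢ p (suc i)
  a≢p[suc] i e with () ← p-inj e

  p′ : Fin d → Fin n
  p′ i = punchOut (a≢p[suc] i)

  p′-inj : Injective _≡_ _≡_ p′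
  p′-inj {i} {j} e = suc-injective (p-inj (punchOut-injective (a≢p[suc] i) (a≢p[suc] j) e))

  c′ : Fin n → Fin (suc (n ∸ d))
  c′ = proj₁ (markImage p′ p′-inj)

  open MarksImage (proj₂ (markImage p′ p′-inj))
    renaming (image⇒zero to image⇒zero′; zero⇒image to zero⇒image′;
              injective-off-zero to injective-off-zero′)

  c : Fin (suc n) → Fin (suc (n ∸ d))
  c w with a ≟ w
  ... | yes _   = zero
  ... | no a≢w = c′ (punchOut a≢w)

  image⇒zero : ∀ i → c (p i) ≡ zero
  image⇒zero zero with a ≟ a
  ... | yes _   = refl
  ... | no a≢a = ⊥-elim (a≢a refl)
  image⇒zero (suc i) with a ≟ p (suc i)
  ... | yes a≡p = ⊥-elim (a≢p[suc] i a≡p)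
  ... | no a≢p  = trans (cong c′ (punchOut-cong a refl)) (image⇒zero′ i)

  zero⇒image : ∀ w → c w ≡ zero → ∃ λ i → p i ≡ w
  zero⇒image w e with a ≟ w
  ... | yes a≡w = zero , a≡w
  ... | no a≢w with i , p′i≡ ← zero⇒image′ (punchOut a≢w) e =
    suc i , punchOut-injective (a≢p[suc] i) a≢w p′i≡

  injective-off-zero : ∀ w w′ → c w ≡ c w′ → w ≡ w′ ⊎ c w ≡ zero
  injective-off-zero w w′ e with a ≟ w | a ≟ w′
  ... | yes a≡w | yes a≡w′ = inj₁ (trans (sym a≡w) a≡w′)
  ... | yes _   | no _     = inj₂ refl
  ... | no _    | yes _    = inj₂ e
  ... | no a≢w  | no a≢w′ with injective-off-zero′ _ _ e
  ...   | inj₁ eq = inj₁ (punchOut-injective a≢w a≢w′ eq)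
  ...   | inj₂ z  = inj₂ z

fixed-or-marked : ∀ {d n m} {p : Fin d → Fin n} {c : Fin n → Fin (suc m)} → MarksImage p c →
                  ∀ {σ : Fin n → Fin n} → (∀ v → c (σ v) ≡ c v) →
                  ∀ w → σ w ≡ w ⊎ ∃ λ i → p i ≡ w
fixed-or-marked marks {σ} c∘σ≡c w
  with MarksImage.injective-off-zero marks w (σ w) (sym (c∘σ≡c w))
... | inj₁ w≡σw = inj₁ (sym w≡σw)
... | inj₂ cw≡0 = inj₂ (MarksImage.zero⇒image marks w cw≡0)

injective∧deflationary⇒≗id : ∀ {d} {τ : Fin d → Fin d} → Injective _≡_ _≡_ τ →
                             (∀ k → τ k Fin.≤ k) → τ ≗ id
injective∧deflationary⇒≗id {τ = τ} τ-inj τ≤ k = go k (<-wellFounded k)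
  where
  go : ∀ k → Acc _<_ k → τ k ≡ k
  go k (acc rec) with <-cmp (τ k) k
  ... | tri< τk<k _ _ = ⊥-elim (<-irrefl (τ-inj (go (τ k) (rec τk<k))) τk<k)
  ... | tri≈ _ τk≡k _ = τk≡k
  ... | tri> _ _ k<τk = ⊥-elim (<⇒≱ k<τk (τ≤ k))

module _ {n} {G : Graph n} where

  vertexAt : ∀ {u v k} → Walk G u v k → Fin (suc k) → Fin n
  vertexAt {u} V          zero    = u
  vertexAt     here       (suc ())
  vertexAt     (step _ V) (suc i) = vertexAt V i

  takeʷ : ∀ {u v k} (V : Walk G u v k) (i : Fin (suc k)) → Walk G u (vertexAt V i) (toℕ i)
  takeʷ V          zero    = here
  takeʷ (step a V) (suc i) = step a (takeʷ V i)

  dropʷ : ∀ {u v k} (V : Walk G u v k) (i : Fin (suc k)) → Walk G (vertexAt V i) v (k ∸ toℕ i)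
  dropʷ V          zero    = V
  dropʷ (step a V) (suc i) = dropʷ V i

  _++ʷ_ : ∀ {u w v k l} → Walk G u w k → Walk G w v l → Walk G u v (k + l)
  here     ++ʷ V = V
  step a U ++ʷ V = step a (U ++ʷ V)

  mapʷ : (σ : Fin n → Fin n) → (∀ u v → adj G (σ u) (σ v) ≡ adj G u v) →
         ∀ {u v k} → Walk G u v k → Walk G (σ u) (σ v) k
  mapʷ σ σ-adj here       = here
  mapʷ σ σ-adj (step a V) = step (trans (σ-adj _ _) a) (mapʷ σ σ-adj V)

module Geodesic {n} {G : Graph n} {x y d} (V : Walk G x y d)
                (shortest : ∀ k → Walk G x y k → d ≤ k) where

  prefix-shortest : ∀ i {k} → Walk G x (vertexAt V i) k → toℕ i ≤ k
  prefix-shortest i {k} U = begin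
    toℕ i               ≡⟨ sym (m∸[m∸n]≡n (toℕ≤pred[n] i)) ⟩
    d ∸ (d ∸ toℕ i)     ≤⟨ m≤n+o⇒m∸n≤o d (d ∸ toℕ i) d≤[d∸i]+k ⟩
    k                   ∎
    where
    open ≤-Reasoning
    d≤[d∸i]+k : d ≤ (d ∸ toℕ i) + k
    d≤[d∸i]+k = subst (d ≤_) (+-comm k _) (shortest _ (U ++ʷ dropʷ V i))

  vertexAt-<⇒≢ : ∀ {i j} → i < j → vertexAt V i ≢ vertexAt V j
  vertexAt-<⇒≢ {i} {j} i<j e =
    <⇒≱ i<j (prefix-shortest j (subst (λ w → Walk G x w _) e (takeʷ V i)))

  vertexAt-injective : Injective _≡_ _≡_ (vertexAt V)
  vertexAt-injective {i} {j} e with <-cmp i j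
  ... | tri< i<j _ _ = ⊥-elim (vertexAt-<⇒≢ i<j e)
  ... | tri≈ _ i≡j _ = i≡j
  ... | tri> _ _ j<i = ⊥-elim (vertexAt-<⇒≢ j<i (sym e))

  pathVertex : Fin d → Fin n
  pathVertex k = vertexAt V (suc k)

  pathVertex-injective : Injective _≡_ _≡_ pathVertex
  pathVertex-injective e = suc-injective (vertexAt-injective e)

  pathColouring : Fin n → Fin (suc (n ∸ d))
  pathColouring = proj₁ (markImage pathVertex pathVertex-injective)

  private
    marks : MarksImage pathVertex pathColouring
    marks = proj₂ (markImage pathVertex pathVertex-injective)
    open MarksImage marks

  pathColouring-distinguishing : Distinguishing G pathColouring
  pathColouring-distinguishing σ (σ-inj , σ-adj) c∘σ≡c w
    with fixed-or-marked marks c∘σ≡c w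
  ... | inj₁ σw≡w = σw≡w
  ... | inj₂ (i , pᵢ≡w) = trans (cong σ (sym pᵢ≡w)) (trans (σ∘p≗p i) pᵢ≡w)
    where
    σx≡x : σ x ≡ x
    σx≡x with fixed-or-marked marks c∘σ≡c x
    ... | inj₁ σx≡x = σx≡x
    ... | inj₂ (i , pᵢ≡x) with () ← vertexAt-injective {suc i} {zero} pᵢ≡x

    σp-marked : ∀ k → ∃ λ j → pathVertex j ≡ σ (pathVertex k)
    σp-marked k = zero⇒image _ (trans (c∘σ≡c _) (image⇒zero k))

    τ : Fin d → Fin d
    τ k = proj₁ (σp-marked k)

    p∘τ≡σ∘p : ∀ k → pathVertex (τ k) ≡ σ (pathVertex k)
    p∘τ≡σ∘p k = proj₂ (σp-marked k)

    τ-injective : Injective _≡_ _≡_ τ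
    τ-injective {k} {l} e =
      pathVertex-injective (σ-inj (trans (sym (p∘τ≡σ∘p k)) (trans (cong pathVertex e) (p∘τ≡σ∘p l))))

    τ-deflationary : ∀ k → τ k Fin.≤ k
    τ-deflationary k = s≤s⁻¹ (prefix-shortest (suc (τ k)) walk)
      where
      walk : Walk G x (pathVertex (τ k)) (suc (toℕ k))
      walk = subst₂ (λ u v → Walk G u v _) σx≡x (sym (p∘τ≡σ∘p k))
                    (mapʷ σ σ-adj (takeʷ V (suc k)))

    σ∘p≗p : ∀ k → σ (pathVertex k) ≡ pathVertex k
    σ∘p≗p k = trans (sym (p∘τ≡σ∘p k))
                    (cong pathVertex (injective∧deflationary⇒≗id τ-injective τ-deflationary k))

  hasDistinguishingColouring : HasDistinguishingColouring G (suc (n ∸ d))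
  hasDistinguishingColouring = pathColouring , pathColouring-distinguishing

isDistNumber⇒≤ : ∀ {n} (G : Graph n) {m k} → IsDistNumber G m → HasDistinguishingColouring G k → m ≤ k
isDistNumber⇒≤ G (_ , least) has = ≮⇒≥ (λ k<m → least _ k<m has)

mainTheorem3 : ∀ (n : ℕ) (G : Graph n) → Connected G →
    ∀ (d m : ℕ) → Diam G d → IsDistNumber G m → m ≤ (n ∸ d) + 1
mainTheorem3 n G _ d m ((x , y , V , shortest) , _) D[G]≡m =
  subst (m ≤_) (+-comm 1 (n ∸ d)) (isDistNumber⇒≤ G D[G]≡m hasDistinguishingColouring)
  where open Geodesic V shortest
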